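{- Let $\vec G=(G_0,\dots,G_n)$ be a finite sequence of $\lambda$-terms. (1) If $\vec G$ is a constant fgv, then $\vec G$ is compact. (2) If $\vec G$ is a constant fgv or a constant wfgv, then $\vec G$ is weakly constant. (3) If $\vec G$ is a compact fgv or a compact wfgv, then $\vec G$ is weakly compact.
   Context: Untyped $\lambda$-calculus; $=$ denotes $\beta$-conversion. $M\vec G=MG_0\cdots G_n$; $F^k(z)=F(F(\cdots F(z)\cdots))$ with $k$ copies of $F$. $M=^\infty N$ means $M$ and $N$ have the same Böhm tree. $Y$ is an fpc if $Yx=x(Yx)$ for $x$ not free in $Y$, a wfpc if $Yx=^\infty x(Yx)$; $\mathsf{FPC},\mathsf{WFPC}$ are the sets of these. $\vec G$ is an fgv if $Y\in\mathsf{FPC}\Rightarrow Y\vec G\in\mathsf{FPC}$, and a wfgv if $Y\in\mathsf{WFPC}\Rightarrow Y\vec G\in\mathsf{WFPC}$. Write $z\notin M$ if some $N=M$ has $z$ not free, and $z\notin^\infty M$ if some $N=^\infty M$ has $z$ not free. Fix a variable $z$ not free in $\vec G$. $\vec G$ is: constant if $\exists k$, $z\notin G_0^k(z)G_1\cdots G_n$; weakly constant if $\exists k$, $z\notin^\infty G_0^k(z)G_1\cdots G_n$; compact if $\exists k$, $G_0^k(z)G_1\cdots G_n\in\mathsf{FPC}$; weakly compact if $\exists k$, $G_0^k(z)G_1\cdots G_n\in\mathsf{WFPC}$. -}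

module Defs where

open import Data.Nat using (ℕ; zero; suc; _<ᵇ_; _≡ᵇ_; pred)
open import Data.Bool using (if_then_else_)
open import Data.List using (List; []; _∷_)
open import Data.List.Relation.Binary.Pointwise using (Pointwise)
open import Data.List.Relation.Unary.All using (All)
open import Data.Product using (Σ; _×_; ∃)
open import Data.Sum using (_⊎_)
open import Data.Unit using (⊤)
open import Relation.Nullary using (¬_)
open import Relation.Binary.PropositionalEquality using (_≡_)

-- Untyped λ-terms, de Bruijn indices (free variables = indices that
-- escape all binders).

data Term : Set where
  var : ℕ → Term
  lam : Term → Term
  app : Term → Term → Term

shift : ℕ → Term → Term
shift c (var i) = if i <ᵇ c then var i else var (suc i)
shift c (lam M) = lam (shift (suc c) M)
shift c (app M N) = app (shift c M) (shift c N)

subst : ℕ → Term → Term → Term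
subst j N (var i) =
  if i ≡ᵇ j then N else (if j <ᵇ i then var (pred i) else var i)
subst j N (lam M) = lam (subst (suc j) (shift 0 N) M)
subst j N (app M P) = app (subst j N M) (subst j N P)

data _→β_ : Term → Term → Set where
  beta : ∀ {M N} → app (lam M) N →β subst 0 N M
  ξlam : ∀ {M M'} → M →β M' → lam M →β lam M'
  ξappL : ∀ {M M' N} → M →β M' → app M N →β app M' N
  ξappR : ∀ {M N N'} → N →β N' → app M N →β app M N'

data _=β_ : Term → Term → Set where
  step : ∀ {M N} → M →β N → M =β N
  refl : ∀ {M} → M =β M
  sym : ∀ {M N} → M =β N → N =β M
  trans : ∀ {M N P} → M =β N → N =β P → M =β P

FreeIn : ℕ → Term → Set
FreeIn x (var y) = x ≡ y
FreeIn x (lam M) = FreeIn (suc x) M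
FreeIn x (app M N) = FreeIn x M ⊎ FreeIn x N

apps : Term → List Term → Term
apps M [] = M
apps M (G ∷ Gs) = apps (app M G) Gs

iter : ℕ → Term → Term → Term
iter zero F z = z
iter (suc k) F z = app F (iter k F z)

lams : ℕ → Term → Term
lams zero M = M
lams (suc m) M = lam (lams m M)

Solvable : Term → Set
Solvable M = Σ ℕ λ m → Σ ℕ λ y → Σ (List Term) λ Ps →
  M =β lams m (apps (var y) Ps)

Unsolvable : Term → Set
Unsolvable M = ¬ Solvable M

BTeq : ℕ → Term → Term → Set
BTeq zero M N = ⊤
BTeq (suc k) M N =
  (Unsolvable M × Unsolvable N) ⊎
  (Σ ℕ λ m → Σ ℕ λ y → Σ (List Term) λ Ps → Σ (List Term) λ Qs →
     (M =β lams m (apps (var y) Ps)) ×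
     (N =β lams m (apps (var y) Qs)) ×
     Pointwise (BTeq k) Ps Qs)

_=∞_ : Term → Term → Set
M =∞ N = ∀ k → BTeq k M N

IsFPC : Term → Set
IsFPC Y = ∀ x → ¬ FreeIn x Y → app Y (var x) =β app (var x) (app Y (var x))

IsWFPC : Term → Set
IsWFPC Y = ∀ x → ¬ FreeIn x Y → app Y (var x) =∞ app (var x) (app Y (var x))

-- G⃗ = (G₀ , Gs) with Gs = G₁ ⋯ Gₙ
IsFGV : Term → List Term → Set
IsFGV G₀ Gs = ∀ Y → IsFPC Y → IsFPC (apps Y (G₀ ∷ Gs))

IsWFGV : Term → List Term → Set
IsWFGV G₀ Gs = ∀ Y → IsWFPC Y → IsWFPC (apps Y (G₀ ∷ Gs))

NotIn : ℕ → Term → Set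
NotIn z M = Σ Term λ N → (N =β M) × ¬ FreeIn z N

NotIn∞ : ℕ → Term → Set
NotIn∞ z M = Σ Term λ N → (N =∞ M) × ¬ FreeIn z N

iterApp : ℕ → Term → List Term → ℕ → Term
iterApp k G₀ Gs z = apps (iter k G₀ (var z)) Gs

Constant : ℕ → Term → List Term → Set
Constant z G₀ Gs = Σ ℕ λ k → NotIn z (iterApp k G₀ Gs z)

WeaklyConstant : ℕ → Term → List Term → Set
WeaklyConstant z G₀ Gs = Σ ℕ λ k → NotIn∞ z (iterApp k G₀ Gs z)

Compact : ℕ → Term → List Term → Set
Compact z G₀ Gs = Σ ℕ λ k → IsFPC (iterApp k G₀ Gs z)

WeaklyCompact : ℕ → Term → List Term → Set
WeaklyCompact z G₀ Gs = Σ ℕ λ k → IsWFPC (iterApp k G₀ Gs z)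

FreshFor : ℕ → List Term → Set
FreshFor z Gs = All (λ G → ¬ FreeIn z G) Gs

module Submission where

-- Suppose N =β G₀ᵏ(z) G₁ ⋯ Gₙ with z not free in N. Substituting any P for z
-- gives G₀ᵏ(P) G₁ ⋯ Gₙ =β N. For P = Θ G₀ (Turing's fixed point combinator,
-- Θ G₀ =β G₀ᵏ(Θ G₀)) this says Θ G₀ ⋯ Gₙ =β N, and for P = G₀ z it says
-- G₀ᵏ⁺¹(z) G₁ ⋯ Gₙ =β N. So G₀ᵏ⁺¹(z) G₁ ⋯ Gₙ is convertible to the image
-- Θ G₀ ⋯ Gₙ of an fpc and has all of its free variables, hence is itself an
-- fpc: this is (1). For (2) the witness is N itself. Classically nothing is
-- left to show, but reflexivity of Böhm-tree equality is not constructive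
-- (solvability is undecidable); it is recovered from N x =∞ x (N x), which
-- holds because N =β Θ G₀ ⋯ Gₙ is a wfpc: by Church–Rosser N reduces to
-- λx. x P, where P agrees with itself one level below the agreement of N x
-- with x (N x). Part (3) is the inclusion FPC ⊆ WFPC.

open import Defs
open import Data.Empty using (⊥-elim)
open import Data.List using (List; []; _∷_; map; length)
open import Data.List.Properties using (map-id-local)
open import Data.List.Relation.Binary.Pointwise using (Pointwise; []; _∷_)
import Data.List.Relation.Unary.All as All
open import Data.Nat using (ℕ; zero; suc; pred; _<ᵇ_; _≡ᵇ_; _⊔_; _+_; _<_; _≟_)
open import Data.Nat.Properties
  using (≤-trans; <-irrefl; m≤m⊔n; m≤n⊔m; +-suc; +-identityʳ; n<1+n; suc[m]≤n⇒m≤pred[n])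
open import Data.Product using (∃; ∃₂; _×_; _,_; proj₁; uncurry)
import Data.Product as Product
open import Data.Sum using (_⊎_; inj₁; inj₂; [_,_])
import Data.Sum as Sum
open import Data.Unit using (tt)
open import Data.Bool using (true; false; if_then_else_)
open import Function using (_∘_)
open import Relation.Binary.Bundles using (Setoid)
import Relation.Binary.Reasoning.Setoid
open import Relation.Binary.Construct.Closure.ReflexiveTransitive
  using (Star; ε; _◅_; _◅◅_; gmap; fold)
open import Relation.Nullary using (¬_; yes; no)
import Relation.Binary.PropositionalEquality as ≡
open ≡ using (_≡_; refl; cong; cong₂; _≗_; subst₂)

=β-setoid : Setoid _ _
=β-setoid = record
  { Carrier = Term
  ; _≈_ = _=β_
  ; isEquivalence = record { refl = refl ; sym = sym ; trans = trans }
  }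

module =β-Reasoning = Relation.Binary.Reasoning.Setoid =β-setoid

-- Parallel renaming and substitution

Ren : Set
Ren = ℕ → ℕ

Sub : Set
Sub = ℕ → Term

ext : Ren → Ren
ext ρ zero = zero
ext ρ (suc i) = suc (ρ i)

rename : Ren → Term → Term
rename ρ (var i) = var (ρ i)
rename ρ (lam M) = lam (rename (ext ρ) M)
rename ρ (app M N) = app (rename ρ M) (rename ρ N)

exts : Sub → Sub
exts σ zero = var zero
exts σ (suc i) = rename suc (σ i)

sub : Sub → Term → Term
sub σ (var i) = σ i
sub σ (lam M) = lam (sub (exts σ) M)
sub σ (app M N) = app (sub σ M) (sub σ N)

ext-cong : ∀ {ρ ρ'} → ρ ≗ ρ' → ext ρ ≗ ext ρ'
ext-cong h zero = refl
ext-cong h (suc i) = cong suc (h i)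

rename-cong : ∀ {ρ ρ'} → ρ ≗ ρ' → rename ρ ≗ rename ρ'
rename-cong h (var i) = cong var (h i)
rename-cong h (lam M) = cong lam (rename-cong (ext-cong h) M)
rename-cong h (app M N) = cong₂ app (rename-cong h M) (rename-cong h N)

exts-cong : ∀ {σ τ} → σ ≗ τ → exts σ ≗ exts τ
exts-cong h zero = refl
exts-cong h (suc i) = cong (rename suc) (h i)

sub-cong : ∀ {σ τ} → σ ≗ τ → sub σ ≗ sub τ
sub-cong h (var i) = h i
sub-cong h (lam M) = cong lam (sub-cong (exts-cong h) M)
sub-cong h (app M N) = cong₂ app (sub-cong h M) (sub-cong h N)

rename-rename : ∀ ρ ρ' M → rename ρ (rename ρ' M) ≡ rename (ρ ∘ ρ') M
rename-rename ρ ρ' (var i) = refl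
rename-rename ρ ρ' (lam M) =
  cong lam (≡.trans (rename-rename (ext ρ) (ext ρ') M) (rename-cong ext-∘ M))
  where ext-∘ : ext ρ ∘ ext ρ' ≗ ext (ρ ∘ ρ')
        ext-∘ zero = refl
        ext-∘ (suc i) = refl
rename-rename ρ ρ' (app M N) = cong₂ app (rename-rename ρ ρ' M) (rename-rename ρ ρ' N)

sub-rename : ∀ σ ρ M → sub σ (rename ρ M) ≡ sub (σ ∘ ρ) M
sub-rename σ ρ (var i) = refl
sub-rename σ ρ (lam M) =
  cong lam (≡.trans (sub-rename (exts σ) (ext ρ) M) (sub-cong exts-∘ M))
  where exts-∘ : exts σ ∘ ext ρ ≗ exts (σ ∘ ρ)
        exts-∘ zero = refl
        exts-∘ (suc i) = refl
sub-rename σ ρ (app M N) = cong₂ app (sub-rename σ ρ M) (sub-rename σ ρ N)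

rename-sub : ∀ ρ σ M → rename ρ (sub σ M) ≡ sub (rename ρ ∘ σ) M
rename-sub ρ σ (var i) = refl
rename-sub ρ σ (lam M) =
  cong lam (≡.trans (rename-sub (ext ρ) (exts σ) M) (sub-cong ext-exts M))
  where ext-exts : rename (ext ρ) ∘ exts σ ≗ exts (rename ρ ∘ σ)
        ext-exts zero = refl
        ext-exts (suc i) =
          ≡.trans (rename-rename (ext ρ) suc (σ i)) (≡.sym (rename-rename suc ρ (σ i)))
rename-sub ρ σ (app M N) = cong₂ app (rename-sub ρ σ M) (rename-sub ρ σ N)

sub-sub : ∀ σ τ M → sub σ (sub τ M) ≡ sub (sub σ ∘ τ) M
sub-sub σ τ (var i) = refl
sub-sub σ τ (lam M) =
  cong lam (≡.trans (sub-sub (exts σ) (exts τ) M) (sub-cong exts-exts M))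
  where exts-exts : sub (exts σ) ∘ exts τ ≗ exts (sub σ ∘ τ)
        exts-exts zero = refl
        exts-exts (suc i) =
          ≡.trans (sub-rename (exts σ) suc (τ i)) (≡.sym (rename-sub suc σ (τ i)))
sub-sub σ τ (app M N) = cong₂ app (sub-sub σ τ M) (sub-sub σ τ N)

sub-var : ∀ {σ} → σ ≗ var → ∀ M → sub σ M ≡ M
sub-var h (var i) = h i
sub-var {σ} h (lam M) = cong lam (sub-var exts-var M)
  where exts-var : exts σ ≗ var
        exts-var zero = refl
        exts-var (suc i) = cong (rename suc) (h i)
sub-var h (app M N) = cong₂ app (sub-var h M) (sub-var h N)

rename≡sub : ∀ ρ M → rename ρ M ≡ sub (var ∘ ρ) M
rename≡sub ρ (var i) = refl
rename≡sub ρ (lam M) = cong lam (≡.trans (rename≡sub (ext ρ) M) (sub-cong ext-var M))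
  where ext-var : var ∘ ext ρ ≗ exts (var ∘ ρ)
        ext-var zero = refl
        ext-var (suc i) = refl
rename≡sub ρ (app M N) = cong₂ app (rename≡sub ρ M) (rename≡sub ρ N)

rename-id : ∀ {ρ} → (∀ i → ρ i ≡ i) → ∀ M → rename ρ M ≡ M
rename-id h M = ≡.trans (rename≡sub _ M) (sub-var (cong var ∘ h) M)

sub₀ : Term → Sub
sub₀ N zero = N
sub₀ N (suc i) = var i

shiftRen : ℕ → Ren
shiftRen c i = if i <ᵇ c then i else suc i

shift≡rename : ∀ c M → shift c M ≡ rename (shiftRen c) M
shift≡rename c (var i) with i <ᵇ c
... | true = refl
... | false = refl
shift≡rename c (lam M) = cong lam (≡.trans (shift≡rename (suc c) M) (rename-cong shiftRen-suc M))
  where shiftRen-suc : shiftRen (suc c) ≗ ext (shiftRen c)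
        shiftRen-suc zero = refl
        shiftRen-suc (suc i) with i <ᵇ c
        ... | true = refl
        ... | false = refl
shift≡rename c (app M N) = cong₂ app (shift≡rename c M) (shift≡rename c N)

substSub : ℕ → Term → Sub
substSub j N i = if i ≡ᵇ j then N else (if j <ᵇ i then var (pred i) else var i)

subst≡sub : ∀ j N M → subst j N M ≡ sub (substSub j N) M
subst≡sub j N (var i) = refl
subst≡sub j N (lam M) =
  cong lam (≡.trans (subst≡sub (suc j) (shift 0 N) M) (sub-cong substSub-suc M))
  where
    shift0 : shift 0 N ≡ rename suc N
    shift0 = ≡.trans (shift≡rename 0 N) (rename-cong (λ _ → refl) N)
    substSub-suc : substSub (suc j) (shift 0 N) ≗ exts (substSub j N)
    substSub-suc zero = refl
    substSub-suc (suc zero) with zero ≡ᵇ j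
    ... | true = shift0
    ... | false = refl
    substSub-suc (suc (suc i)) with suc i ≡ᵇ j | j <ᵇ suc i
    ... | true | _ = shift0
    ... | false | true = refl
    ... | false | false = refl
subst≡sub j N (app M P) = cong₂ app (subst≡sub j N M) (subst≡sub j N P)

subst0≡sub : ∀ N M → subst 0 N M ≡ sub (sub₀ N) M
subst0≡sub N M = ≡.trans (subst≡sub 0 N M) (sub-cong agree M)
  where agree : substSub 0 N ≗ sub₀ N
        agree zero = refl
        agree (suc i) = refl

sub-subst0 : ∀ σ N M → sub σ (subst 0 N M) ≡ subst 0 (sub σ N) (sub (exts σ) M)
sub-subst0 σ N M = begin
  sub σ (subst 0 N M)                  ≡⟨ cong (sub σ) (subst0≡sub N M) ⟩
  sub σ (sub (sub₀ N) M)               ≡⟨ sub-sub σ (sub₀ N) M ⟩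
  sub (sub σ ∘ sub₀ N) M               ≡⟨ sub-cong agree M ⟩
  sub (sub (sub₀ (sub σ N)) ∘ exts σ) M ≡⟨ ≡.sym (sub-sub (sub₀ (sub σ N)) (exts σ) M) ⟩
  sub (sub₀ (sub σ N)) (sub (exts σ) M) ≡⟨ ≡.sym (subst0≡sub (sub σ N) (sub (exts σ) M)) ⟩
  subst 0 (sub σ N) (sub (exts σ) M)   ∎
  where
    open ≡.≡-Reasoning
    agree : sub σ ∘ sub₀ N ≗ sub (sub₀ (sub σ N)) ∘ exts σ
    agree zero = refl
    agree (suc i) =
      ≡.sym (≡.trans (sub-rename (sub₀ (sub σ N)) suc (σ i)) (sub-var (λ _ → refl) (σ i)))

rename-subst0 : ∀ ρ N M → rename ρ (subst 0 N M) ≡ subst 0 (rename ρ N) (rename (ext ρ) M)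
rename-subst0 ρ N M = begin
  rename ρ (subst 0 N M)
    ≡⟨ rename≡sub ρ _ ⟩
  sub (var ∘ ρ) (subst 0 N M)
    ≡⟨ sub-subst0 (var ∘ ρ) N M ⟩
  subst 0 (sub (var ∘ ρ) N) (sub (exts (var ∘ ρ)) M)
    ≡⟨ cong₂ (subst 0) (≡.sym (rename≡sub ρ N)) ext-rename ⟩
  subst 0 (rename ρ N) (rename (ext ρ) M) ∎
  where
    open ≡.≡-Reasoning
    ext-var : var ∘ ext ρ ≗ exts (var ∘ ρ)
    ext-var zero = refl
    ext-var (suc i) = refl
    ext-rename : sub (exts (var ∘ ρ)) M ≡ rename (ext ρ) M
    ext-rename = ≡.sym (≡.trans (rename≡sub (ext ρ) M) (sub-cong ext-var M))

_↠_ : Term → Term → Set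
_↠_ = Star _→β_

↠-lam : ∀ {M N} → M ↠ N → lam M ↠ lam N
↠-lam = gmap lam ξlam

↠-appˡ : ∀ {M N P} → M ↠ N → app M P ↠ app N P
↠-appˡ = gmap _ ξappL

↠-appʳ : ∀ {M N P} → M ↠ N → app P M ↠ app P N
↠-appʳ = gmap _ ξappR

↠⇒=β : ∀ {M N} → M ↠ N → M =β N
↠⇒=β = fold _=β_ (λ s e → trans (step s) e) refl

=β-map : ∀ (f : Term → Term) → (∀ {M N} → M →β N → f M →β f N) → ∀ {M N} → M =β N → f M =β f N
=β-map f f-→β (step s) = step (f-→β s)
=β-map f f-→β refl = refl
=β-map f f-→β (sym e) = sym (=β-map f f-→β e)
=β-map f f-→β (trans e e') = trans (=β-map f f-→β e) (=β-map f f-→β e')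

=β-appˡ : ∀ {M N P} → M =β N → app M P =β app N P
=β-appˡ = =β-map _ ξappL

=β-appʳ : ∀ {M N P} → M =β N → app P M =β app P N
=β-appʳ = =β-map _ ξappR

sub-→β : ∀ σ {M M'} → M →β M' → sub σ M →β sub σ M'
sub-→β σ (beta {M} {N}) =
  ≡.subst (app (lam (sub (exts σ) M)) (sub σ N) →β_) (≡.sym (sub-subst0 σ N M)) beta
sub-→β σ (ξlam s) = ξlam (sub-→β (exts σ) s)
sub-→β σ (ξappL s) = ξappL (sub-→β σ s)
sub-→β σ (ξappR s) = ξappR (sub-→β σ s)

sub-=β : ∀ σ {M M'} → M =β M' → sub σ M =β sub σ M'
sub-=β σ = =β-map (sub σ) (sub-→β σ)

rename-→β : ∀ ρ {M M'} → M →β M' → rename ρ M →β rename ρ M'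
rename-→β ρ {M} {M'} s =
  subst₂ _→β_ (≡.sym (rename≡sub ρ M)) (≡.sym (rename≡sub ρ M')) (sub-→β (var ∘ ρ) s)

rename-↠ : ∀ ρ {M M'} → M ↠ M' → rename ρ M ↠ rename ρ M'
rename-↠ ρ = gmap (rename ρ) (rename-→β ρ)

rename-=β : ∀ ρ {M M'} → M =β M' → rename ρ M =β rename ρ M'
rename-=β ρ = =β-map (rename ρ) (rename-→β ρ)

-- Church–Rosser via Takahashi's complete developments

infix 4 _⇉_
data _⇉_ : Term → Term → Set where
  pvar : ∀ {i} → var i ⇉ var i
  plam : ∀ {M M'} → M ⇉ M' → lam M ⇉ lam M'
  papp : ∀ {M M' N N'} → M ⇉ M' → N ⇉ N' → app M N ⇉ app M' N'
  pbeta : ∀ {M M' N N'} → M ⇉ M' → N ⇉ N' → app (lam M) N ⇉ subst 0 N' M'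

⇉-refl : ∀ M → M ⇉ M
⇉-refl (var i) = pvar
⇉-refl (lam M) = plam (⇉-refl M)
⇉-refl (app M N) = papp (⇉-refl M) (⇉-refl N)

→β⇒⇉ : ∀ {M N} → M →β N → M ⇉ N
→β⇒⇉ (beta {M} {N}) = pbeta (⇉-refl M) (⇉-refl N)
→β⇒⇉ (ξlam s) = plam (→β⇒⇉ s)
→β⇒⇉ (ξappL {N = N} s) = papp (→β⇒⇉ s) (⇉-refl N)
→β⇒⇉ (ξappR {M = M} s) = papp (⇉-refl M) (→β⇒⇉ s)

⇉⇒↠ : ∀ {M N} → M ⇉ N → M ↠ N
⇉⇒↠ pvar = ε
⇉⇒↠ (plam p) = ↠-lam (⇉⇒↠ p)
⇉⇒↠ (papp p q) = ↠-appˡ (⇉⇒↠ p) ◅◅ ↠-appʳ (⇉⇒↠ q)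
⇉⇒↠ (pbeta p q) = ↠-appˡ (↠-lam (⇉⇒↠ p)) ◅◅ ↠-appʳ (⇉⇒↠ q) ◅◅ (beta ◅ ε)

rename-⇉ : ∀ ρ {M M'} → M ⇉ M' → rename ρ M ⇉ rename ρ M'
rename-⇉ ρ pvar = pvar
rename-⇉ ρ (plam p) = plam (rename-⇉ (ext ρ) p)
rename-⇉ ρ (papp p q) = papp (rename-⇉ ρ p) (rename-⇉ ρ q)
rename-⇉ ρ (pbeta {M} {M'} {N} {N'} p q) =
  ≡.subst (rename ρ (app (lam M) N) ⇉_) (≡.sym (rename-subst0 ρ N' M'))
    (pbeta (rename-⇉ (ext ρ) p) (rename-⇉ ρ q))

exts-⇉ : ∀ {σ τ} → (∀ i → σ i ⇉ τ i) → ∀ i → exts σ i ⇉ exts τ i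
exts-⇉ h zero = pvar
exts-⇉ h (suc i) = rename-⇉ suc (h i)

sub-⇉ : ∀ {σ τ} → (∀ i → σ i ⇉ τ i) → ∀ {M M'} → M ⇉ M' → sub σ M ⇉ sub τ M'
sub-⇉ h (pvar {i}) = h i
sub-⇉ h (plam p) = plam (sub-⇉ (exts-⇉ h) p)
sub-⇉ h (papp p q) = papp (sub-⇉ h p) (sub-⇉ h q)
sub-⇉ {σ} {τ} h (pbeta {M} {M'} {N} {N'} p q) =
  ≡.subst (sub σ (app (lam M) N) ⇉_) (≡.sym (sub-subst0 τ N' M'))
    (pbeta (sub-⇉ (exts-⇉ h) p) (sub-⇉ h q))

subst0-⇉ : ∀ {M M' N N'} → M ⇉ M' → N ⇉ N' → subst 0 N M ⇉ subst 0 N' M'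
subst0-⇉ {M} {M'} {N} {N'} p q =
  subst₂ _⇉_ (≡.sym (subst0≡sub N M)) (≡.sym (subst0≡sub N' M')) (sub-⇉ sub₀-⇉ p)
  where sub₀-⇉ : ∀ i → sub₀ N i ⇉ sub₀ N' i
        sub₀-⇉ zero = q
        sub₀-⇉ (suc i) = pvar

_⁺ : Term → Term
var i ⁺ = var i
lam M ⁺ = lam (M ⁺)
app (var i) N ⁺ = app (var i) (N ⁺)
app (lam M) N ⁺ = subst 0 (N ⁺) (M ⁺)
app (app M₁ M₂) N ⁺ = app (app M₁ M₂ ⁺) (N ⁺)

⇉-⁺ : ∀ {M N} → M ⇉ N → N ⇉ M ⁺
⇉-⁺ pvar = pvar
⇉-⁺ (plam p) = plam (⇉-⁺ p)
⇉-⁺ (papp {var i} pvar q) = papp pvar (⇉-⁺ q)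
⇉-⁺ (papp {lam M} (plam p) q) = pbeta (⇉-⁺ p) (⇉-⁺ q)
⇉-⁺ (papp {app M₁ M₂} p q) = papp (⇉-⁺ p) (⇉-⁺ q)
⇉-⁺ (pbeta p q) = subst0-⇉ (⇉-⁺ p) (⇉-⁺ q)

strip : ∀ {M N₁ N₂} → M ⇉ N₁ → M ↠ N₂ → ∃ λ P → N₁ ↠ P × N₂ ⇉ P
strip p ε = _ , ε , p
strip p (s ◅ r) with strip (⇉-⁺ (→β⇒⇉ s)) r
... | P , N₁↠P , N₂⇉P = P , ⇉⇒↠ (⇉-⁺ p) ◅◅ N₁↠P , N₂⇉P

↠-confluent : ∀ {M N₁ N₂} → M ↠ N₁ → M ↠ N₂ → ∃ λ P → N₁ ↠ P × N₂ ↠ P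
↠-confluent ε r = _ , r , ε
↠-confluent (s ◅ r₁) r₂ with strip (→β⇒⇉ s) r₂
... | Q , a , b with ↠-confluent r₁ a
... | P , c , d = P , c , ⇉⇒↠ b ◅◅ d

church-rosser : ∀ {M N} → M =β N → ∃ λ P → M ↠ P × N ↠ P
church-rosser (step s) = _ , s ◅ ε , ε
church-rosser refl = _ , ε , ε
church-rosser (sym e) with church-rosser e
... | P , a , b = P , b , a
church-rosser (trans e e') with church-rosser e | church-rosser e'
... | P , a , b | Q , c , d with ↠-confluent b c
... | R , f , g = R , a ◅◅ f , d ◅◅ g

-- Free variables

FreeIn-rename : ∀ ρ {x} M → FreeIn x (rename ρ M) → ∃ λ i → FreeIn i M × x ≡ ρ i
FreeIn-rename ρ (var i) e = i , refl , e
FreeIn-rename ρ (lam M) f with FreeIn-rename (ext ρ) M f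
... | suc i , fi , e = i , fi , cong pred e
FreeIn-rename ρ (app M N) (inj₁ f) = Product.map₂ (Product.map₁ inj₁) (FreeIn-rename ρ M f)
FreeIn-rename ρ (app M N) (inj₂ f) = Product.map₂ (Product.map₁ inj₂) (FreeIn-rename ρ N f)

FreeIn-sub : ∀ σ {x} M → FreeIn x (sub σ M) → ∃ λ i → FreeIn i M × FreeIn x (σ i)
FreeIn-sub σ (var i) f = i , refl , f
FreeIn-sub σ (lam M) f with FreeIn-sub (exts σ) M f
... | suc i , fi , fx with FreeIn-rename suc (σ i) fx
... | j , fj , refl = i , fi , fj
FreeIn-sub σ (app M N) (inj₁ f) = Product.map₂ (Product.map₁ inj₁) (FreeIn-sub σ M f)
FreeIn-sub σ (app M N) (inj₂ f) = Product.map₂ (Product.map₁ inj₂) (FreeIn-sub σ N f)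

sub-cong-FreeIn : ∀ M {σ τ} → (∀ i → FreeIn i M → σ i ≡ τ i) → sub σ M ≡ sub τ M
sub-cong-FreeIn (var i) h = h i refl
sub-cong-FreeIn (lam M) {σ} {τ} h = cong lam (sub-cong-FreeIn M exts-agree)
  where exts-agree : ∀ i → FreeIn i M → exts σ i ≡ exts τ i
        exts-agree zero f = refl
        exts-agree (suc i) f = cong (rename suc) (h i f)
sub-cong-FreeIn (app M N) h =
  cong₂ app (sub-cong-FreeIn M (λ i → h i ∘ inj₁)) (sub-cong-FreeIn N (λ i → h i ∘ inj₂))

sub-FreeIn-var : ∀ M {σ} → (∀ i → FreeIn i M → σ i ≡ var i) → sub σ M ≡ M
sub-FreeIn-var M h = ≡.trans (sub-cong-FreeIn M h) (sub-var (λ _ → refl) M)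

→β-FreeIn : ∀ {M M' x} → M →β M' → FreeIn x M' → FreeIn x M
→β-FreeIn {x = x} (beta {M} {N}) f with FreeIn-sub (sub₀ N) M (≡.subst (FreeIn x) (subst0≡sub N M) f)
... | zero , fi , fx = inj₂ fx
... | suc i , fi , refl = inj₁ fi
→β-FreeIn (ξlam s) f = →β-FreeIn s f
→β-FreeIn (ξappL s) = Sum.map₁ (→β-FreeIn s)
→β-FreeIn (ξappR s) = Sum.map₂ (→β-FreeIn s)

↠-FreeIn : ∀ {M M' x} → M ↠ M' → FreeIn x M' → FreeIn x M
↠-FreeIn ε f = f
↠-FreeIn (s ◅ r) f = →β-FreeIn s (↠-FreeIn r f)

FreeIn-apps-mono : ∀ {M M'} → (∀ {x} → FreeIn x M → FreeIn x M') →
                   ∀ Gs {x} → FreeIn x (apps M Gs) → FreeIn x (apps M' Gs)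
FreeIn-apps-mono h [] f = h f
FreeIn-apps-mono h (G ∷ Gs) f = FreeIn-apps-mono (Sum.map₁ h) Gs f

bound : Term → ℕ
bound (var i) = suc i
bound (lam M) = pred (bound M)
bound (app M N) = bound M ⊔ bound N

FreeIn⇒<bound : ∀ {x} M → FreeIn x M → x < bound M
FreeIn⇒<bound (var i) refl = n<1+n i
FreeIn⇒<bound (lam M) f = suc[m]≤n⇒m≤pred[n] (FreeIn⇒<bound M f)
FreeIn⇒<bound (app M N) (inj₁ f) = ≤-trans (FreeIn⇒<bound M f) (m≤m⊔n (bound M) (bound N))
FreeIn⇒<bound (app M N) (inj₂ f) = ≤-trans (FreeIn⇒<bound N f) (m≤n⊔m (bound M) (bound N))

bound-fresh : ∀ M → ¬ FreeIn (bound M) M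
bound-fresh M f = <-irrefl refl (FreeIn⇒<bound M f)

data Ne (y : ℕ) : ℕ → Term → Set where
  ne0 : Ne y 0 (var y)
  neS : ∀ {n M N} → Ne y n M → Ne y (suc n) (app M N)

Ne-→β : ∀ {y n M M'} → Ne y n M → M →β M' → Ne y n M'
Ne-→β (neS ne) (ξappL s) = neS (Ne-→β ne s)
Ne-→β (neS ne) (ξappR s) = neS ne

Ne-apps : ∀ {y n M} → Ne y n M → ∀ Qs → Ne y (n + length Qs) (apps M Qs)
Ne-apps {n = n} ne [] = ≡.subst (λ k → Ne _ k _) (≡.sym (+-identityʳ n)) ne
Ne-apps {y} {n} {M} ne (Q ∷ Qs) =
  ≡.subst (λ k → Ne y k (apps (app M Q) Qs)) (≡.sym (+-suc n (length Qs))) (Ne-apps (neS ne) Qs)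

lams-Ne-↠ : ∀ m {y n M C} → Ne y n M → lams m M ↠ C → ∃ λ M' → C ≡ lams m M' × Ne y n M'
lams-Ne-↠ m ne ε = _ , refl , ne
lams-Ne-↠ m ne (s ◅ r) with lams-Ne-→β m ne s
  where lams-Ne-→β : ∀ m {y n M C} → Ne y n M → lams m M →β C → ∃ λ M' → C ≡ lams m M' × Ne y n M'
        lams-Ne-→β zero ne s = _ , refl , Ne-→β ne s
        lams-Ne-→β (suc m) ne (ξlam s) = Product.map₂ (Product.map₁ (cong lam)) (lams-Ne-→β m ne s)
... | M' , refl , ne' = lams-Ne-↠ m ne' r

var-app≡lams-Ne : ∀ {m y n x D M} → app (var x) D ≡ lams m M → Ne y n M → m ≡ 0 × y ≡ x × n ≡ 1
var-app≡lams-Ne {zero} refl (neS ne0) = refl , refl , refl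

var-↠ : ∀ {x C} → var x ↠ C → C ≡ var x
var-↠ ε = refl

var-app-↠ : ∀ {x P C} → app (var x) P ↠ C → ∃ λ P' → C ≡ app (var x) P' × P ↠ P'
var-app-↠ ε = _ , refl , ε
var-app-↠ (ξappR s ◅ r) = Product.map₂ (Product.map₂ (s ◅_)) (var-app-↠ r)

app-↠-inv : ∀ {A B R} → app A B ↠ R →
  (∃₂ λ A' B' → A ↠ A' × B ↠ B' × R ≡ app A' B') ⊎
  (∃₂ λ M B' → A ↠ lam M × B ↠ B' × subst 0 B' M ↠ R)
app-↠-inv ε = inj₁ (_ , _ , ε , ε , refl)
app-↠-inv (beta ◅ r) = inj₂ (_ , _ , ε , ε , r)
app-↠-inv (ξappL s ◅ r) with app-↠-inv r
... | inj₁ (A' , B' , a , b , e) = inj₁ (A' , B' , s ◅ a , b , e)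
... | inj₂ (M , B' , a , b , c) = inj₂ (M , B' , s ◅ a , b , c)
app-↠-inv (ξappR s ◅ r) with app-↠-inv r
... | inj₁ (A' , B' , a , b , e) = inj₁ (A' , B' , a , s ◅ b , e)
... | inj₂ (M , B' , a , b , c) = inj₂ (M , B' , a , s ◅ b , c)

bind : ℕ → Ren
bind x i with i ≟ x
... | yes _ = 0
... | no _ = suc i

unbind : ℕ → Ren
unbind x zero = x
unbind x (suc i) = i

unbind-bind : ∀ x i → unbind x (bind x i) ≡ i
unbind-bind x i with i ≟ x
... | yes i≡x = ≡.sym i≡x
... | no _ = refl

bind-self : ∀ x → bind x x ≡ 0
bind-self x with x ≟ x
... | yes _ = refl
... | no x≢x = ⊥-elim (x≢x refl)

rename-bind-subst0 : ∀ x M → ¬ FreeIn x (lam M) → rename (bind x) (subst 0 (var x) M) ≡ M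
rename-bind-subst0 x M x∉λM = begin
  rename (bind x) (subst 0 (var x) M)      ≡⟨ cong (rename (bind x)) (subst0≡sub (var x) M) ⟩
  rename (bind x) (sub (sub₀ (var x)) M)   ≡⟨ rename-sub (bind x) (sub₀ (var x)) M ⟩
  sub (rename (bind x) ∘ sub₀ (var x)) M   ≡⟨ sub-FreeIn-var M bind-sub₀ ⟩
  M                                        ∎
  where
    open ≡.≡-Reasoning
    bind-sub₀ : ∀ i → FreeIn i M → rename (bind x) (sub₀ (var x) i) ≡ var i
    bind-sub₀ zero f = cong var (bind-self x)
    bind-sub₀ (suc i) f with i ≟ x
    ... | yes refl = ⊥-elim (x∉λM f)
    ... | no _ = refl

↠-unapply : ∀ {N x P} → ¬ FreeIn x N → app N (var x) ↠ app (var x) P →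
            N ↠ lam (app (var 0) (rename (bind x) P))
↠-unapply {N} {x} {P} x∉N r with app-↠-inv r
... | inj₁ (A , B , N↠A , _ , refl) = ⊥-elim (x∉N (↠-FreeIn N↠A refl))
... | inj₂ (M , B , N↠λM , x↠B , Mx↠xP) with var-↠ x↠B
... | refl = N↠λM ◅◅ ↠-lam M↠0P
  where
    x∉λM : ¬ FreeIn x (lam M)
    x∉λM f = x∉N (↠-FreeIn N↠λM f)
    M↠0P : M ↠ app (var 0) (rename (bind x) P)
    M↠0P = subst₂ _↠_ (rename-bind-subst0 x M x∉λM)
             (cong (λ k → app (var k) (rename (bind x) P)) (bind-self x))
             (rename-↠ (bind x) Mx↠xP)

-- Böhm-tree equality

BTeq-resp-=β : ∀ j {A B A' B'} → BTeq j A B → A =β A' → B =β B' → BTeq j A' B'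
BTeq-resp-=β zero _ _ _ = tt
BTeq-resp-=β (suc j) (inj₁ (uA , uB)) eA eB =
  inj₁ ( (λ (m , y , Ps , e) → uA (m , y , Ps , trans eA e))
       , (λ (m , y , Ps , e) → uB (m , y , Ps , trans eB e)))
BTeq-resp-=β (suc j) (inj₂ (m , y , Ps , Qs , e₁ , e₂ , pw)) eA eB =
  inj₂ (m , y , Ps , Qs , trans (sym eA) e₁ , trans (sym eB) e₂ , pw)

BTeq-reflˡ : ∀ j {A B} → BTeq j A B → BTeq j A A
BTeq-reflˡ zero _ = tt
BTeq-reflˡ (suc j) (inj₁ (u , _)) = inj₁ (u , u)
BTeq-reflˡ (suc j) (inj₂ (m , y , Ps , Qs , e₁ , e₂ , pw)) =
  inj₂ (m , y , Ps , Ps , e₁ , e₁ , reflˡ pw)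
  where reflˡ : ∀ {Ps Qs} → Pointwise (BTeq j) Ps Qs → Pointwise (BTeq j) Ps Ps
        reflˡ [] = []
        reflˡ (r ∷ rs) = BTeq-reflˡ j r ∷ reflˡ rs

extⁿ : ℕ → Ren → Ren
extⁿ zero ρ = ρ
extⁿ (suc m) ρ = extⁿ m (ext ρ)

extⁿ-inverse : ∀ m {ρ} ρ' → (∀ i → ρ' (ρ i) ≡ i) → ∀ i → extⁿ m ρ' (extⁿ m ρ i) ≡ i
extⁿ-inverse zero ρ' h = h
extⁿ-inverse (suc m) ρ' h = extⁿ-inverse m (ext ρ') λ { zero → refl ; (suc i) → cong suc (h i) }

rename-apps : ∀ ρ M Ps → rename ρ (apps M Ps) ≡ apps (rename ρ M) (map (rename ρ) Ps)
rename-apps ρ M [] = refl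
rename-apps ρ M (P ∷ Ps) = rename-apps ρ (app M P) Ps

rename-hnf : ∀ m ρ y Ps →
  rename ρ (lams m (apps (var y) Ps)) ≡ lams m (apps (var (extⁿ m ρ y)) (map (rename (extⁿ m ρ)) Ps))
rename-hnf zero ρ y Ps = rename-apps ρ (var y) Ps
rename-hnf (suc m) ρ y Ps = cong lam (rename-hnf m (ext ρ) y Ps)

rename-=β-hnf : ∀ ρ {A} m y Ps → A =β lams m (apps (var y) Ps) →
  rename ρ A =β lams m (apps (var (extⁿ m ρ y)) (map (rename (extⁿ m ρ)) Ps))
rename-=β-hnf ρ m y Ps e = ≡.subst (_ =β_) (rename-hnf m ρ y Ps) (rename-=β ρ e)

Solvable-unrename : ∀ {ρ} ρ' → (∀ i → ρ' (ρ i) ≡ i) → ∀ A → Solvable (rename ρ A) → Solvable A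
Solvable-unrename {ρ} ρ' h A (m , y , Ps , e) =
  m , extⁿ m ρ' y , map (rename (extⁿ m ρ')) Ps ,
  ≡.subst (_=β _) (≡.trans (rename-rename ρ' ρ A) (rename-id h A)) (rename-=β-hnf ρ' m y Ps e)

rename-BTeq : ∀ j {ρ} ρ' → (∀ i → ρ' (ρ i) ≡ i) →
              ∀ {A B} → BTeq j A B → BTeq j (rename ρ A) (rename ρ B)
rename-BTeq zero ρ' h _ = tt
rename-BTeq (suc j) ρ' h {A} {B} (inj₁ (uA , uB)) =
  inj₁ (uA ∘ Solvable-unrename ρ' h A , uB ∘ Solvable-unrename ρ' h B)
rename-BTeq (suc j) {ρ} ρ' h (inj₂ (m , y , Ps , Qs , e₁ , e₂ , pw)) =
  inj₂ ( m , extⁿ m ρ y , map (rename (extⁿ m ρ)) Ps , map (rename (extⁿ m ρ)) Qs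
       , rename-=β-hnf ρ m y Ps e₁ , rename-=β-hnf ρ m y Qs e₂ , rename-args pw)
  where rename-args : ∀ {Ps Qs} → Pointwise (BTeq j) Ps Qs →
                      Pointwise (BTeq j) (map (rename (extⁿ m ρ)) Ps) (map (rename (extⁿ m ρ)) Qs)
        rename-args [] = []
        rename-args (r ∷ rs) = rename-BTeq j (extⁿ m ρ') (extⁿ-inverse m ρ' h) r ∷ rename-args rs

Pointwise-singleton : ∀ {R : Term → Term → Set} {Ps Qs} → Pointwise R Ps Qs → length Qs ≡ 1 →
                      ∃₂ λ P Q → Ps ≡ P ∷ [] × R P Q
Pointwise-singleton (r ∷ []) _ = _ , _ , refl , r

unfold-fixedPoint : ∀ {N x j} → BTeq (suc j) (app N (var x)) (app (var x) (app N (var x))) →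
                    ∃ λ P → app N (var x) =β app (var x) P × BTeq j P P
unfold-fixedPoint {N} {x} (inj₁ (_ , x[Nx]-unsolvable)) =
  ⊥-elim (x[Nx]-unsolvable (0 , x , app N (var x) ∷ [] , refl))
unfold-fixedPoint {j = j} (inj₂ (m , y , Ps , Qs , e₁ , e₂ , pw)) with church-rosser e₂
... | C , x[Nx]↠C , hnf↠C with var-app-↠ x[Nx]↠C | lams-Ne-↠ m (Ne-apps ne0 Qs) hnf↠C
... | D , refl , _ | M' , C≡λM' , ne with var-app≡lams-Ne {m} C≡λM' ne
... | refl , refl , #Qs≡1 with Pointwise-singleton pw #Qs≡1
... | P , Q , refl , P≈Q = P , e₁ , BTeq-reflˡ j P≈Q

fixedPoint-=∞-refl : ∀ {N x} → ¬ FreeIn x N → app N (var x) =∞ app (var x) (app N (var x)) → N =∞ N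
fixedPoint-=∞-refl x∉N W zero = tt
fixedPoint-=∞-refl {N} {x} x∉N W (suc j) with unfold-fixedPoint (W (suc j))
... | P , Nx=xP , P≈P with church-rosser Nx=xP
... | C , Nx↠C , xP↠C with var-app-↠ xP↠C
... | P' , refl , P↠P' = inj₂ (1 , 0 , P₀ ∷ [] , P₀ ∷ [] , N=λ0P₀ , N=λ0P₀ , P₀≈P₀ ∷ [])
  where
    P₀ : Term
    P₀ = rename (bind x) P'
    N=λ0P₀ : N =β lam (app (var 0) P₀)
    N=λ0P₀ = ↠⇒=β (↠-unapply x∉N Nx↠C)
    P₀≈P₀ : BTeq j P₀ P₀
    P₀≈P₀ = rename-BTeq j (unbind x) (unbind-bind x) (BTeq-resp-=β j P≈P (↠⇒=β P↠P') (↠⇒=β P↠P'))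

-- Fixed point combinators

Θ : Term
Θ = app A A
  where A = lam (lam (app (var 0) (app (app (var 1) (var 1)) (var 0))))

Θ-β : ∀ F → app Θ F =β app F (app Θ F)
Θ-β F = trans (step (ξappL beta)) (step beta)

Θ-FPC : IsFPC Θ
Θ-FPC x _ = Θ-β (var x)

Θ-closed : ∀ {x} → ¬ FreeIn x Θ
Θ-closed f with FreeIn⇒<bound Θ f
... | ()

Θ-unfold : ∀ k F → app Θ F =β iter k F (app Θ F)
Θ-unfold zero F = refl
Θ-unfold (suc k) F = trans (Θ-β F) (=β-appʳ (Θ-unfold k F))

FPC-transport : ∀ {Y Y'} → (∀ {x} → FreeIn x Y → FreeIn x Y') → Y =β Y' → IsFPC Y → IsFPC Y'
FPC-transport {Y} {Y'} fv Y=Y' fpc x x∉Y' = begin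
  app Y' (var x)               ≈⟨ =β-appˡ (sym Y=Y') ⟩
  app Y (var x)                ≈⟨ fpc x (x∉Y' ∘ fv) ⟩
  app (var x) (app Y (var x))  ≈⟨ =β-appʳ (=β-appˡ Y=Y') ⟩
  app (var x) (app Y' (var x)) ∎
  where open =β-Reasoning

FPC⇒WFPC : ∀ {Y} → IsFPC Y → IsWFPC Y
FPC⇒WFPC {Y} fpc x x∉Y j = BTeq-unfold j refl (sym Yx=x[Yx])
  where
    Yx=x[Yx] : app Y (var x) =β app (var x) (app Y (var x))
    Yx=x[Yx] = fpc x x∉Y
    BTeq-unfold : ∀ j {A B} → A =β app Y (var x) → B =β app Y (var x) → BTeq j A B
    BTeq-unfold zero _ _ = tt
    BTeq-unfold (suc j) a b =
      inj₂ ( 0 , x , app Y (var x) ∷ [] , app Y (var x) ∷ []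
           , trans a Yx=x[Yx] , trans b Yx=x[Yx] , BTeq-unfold j refl refl ∷ [])

_↦_ : ℕ → Term → Sub
(z ↦ P) i with i ≟ z
... | yes _ = P
... | no _ = var i

↦-self : ∀ z P → (z ↦ P) z ≡ P
↦-self z P with z ≟ z
... | yes _ = refl
... | no z≢z = ⊥-elim (z≢z refl)

sub-↦-fresh : ∀ {z P} G → ¬ FreeIn z G → sub (z ↦ P) G ≡ G
sub-↦-fresh {z} {P} G z∉G = sub-FreeIn-var G ↦-var
  where ↦-var : ∀ i → FreeIn i G → (z ↦ P) i ≡ var i
        ↦-var i f with i ≟ z
        ... | yes refl = ⊥-elim (z∉G f)
        ... | no _ = refl

sub-apps : ∀ σ M Gs → sub σ (apps M Gs) ≡ apps (sub σ M) (map (sub σ) Gs)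
sub-apps σ M [] = refl
sub-apps σ M (G ∷ Gs) = sub-apps σ (app M G) Gs

sub-iter : ∀ σ k F M → sub σ (iter k F M) ≡ iter k (sub σ F) (sub σ M)
sub-iter σ zero F M = refl
sub-iter σ (suc k) F M = cong (app (sub σ F)) (sub-iter σ k F M)

iter-sucʳ : ∀ k F M → iter k F (app F M) ≡ app F (iter k F M)
iter-sucʳ zero F M = refl
iter-sucʳ (suc k) F M = cong (app F) (iter-sucʳ k F M)

apps-=β : ∀ Gs {M M'} → M =β M' → apps M Gs =β apps M' Gs
apps-=β [] e = e
apps-=β (G ∷ Gs) e = apps-=β Gs (=β-appˡ e)

sub-↦-iterApp : ∀ {z G₀ Gs} P k → FreshFor z (G₀ ∷ Gs) →
                sub (z ↦ P) (iterApp k G₀ Gs z) ≡ apps (iter k G₀ P) Gs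
sub-↦-iterApp {z} {G₀} {Gs} P k (z∉G₀ All.∷ z∉Gs) = begin
  sub (z ↦ P) (apps (iter k G₀ (var z)) Gs)
    ≡⟨ sub-apps (z ↦ P) _ Gs ⟩
  apps (sub (z ↦ P) (iter k G₀ (var z))) (map (sub (z ↦ P)) Gs)
    ≡⟨ cong₂ apps (sub-iter (z ↦ P) k G₀ (var z)) (map-id-local (All.map (sub-↦-fresh _) z∉Gs)) ⟩
  apps (iter k (sub (z ↦ P) G₀) ((z ↦ P) z)) Gs
    ≡⟨ cong₂ (λ F Q → apps (iter k F Q) Gs) (sub-↦-fresh G₀ z∉G₀) (↦-self z P) ⟩
  apps (iter k G₀ P) Gs ∎
  where open ≡.≡-Reasoning

module Constancy {G₀ : Term} {Gs : List Term} {z k : ℕ} {N : Term}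
                 (z-fresh : FreshFor z (G₀ ∷ Gs))
                 (N=G₀ᵏ : N =β iterApp k G₀ Gs z) (z∉N : ¬ FreeIn z N) where

  iter-instance-=β : ∀ P → apps (iter k G₀ P) Gs =β N
  iter-instance-=β P = begin
    apps (iter k G₀ P) Gs            ≡⟨ ≡.sym (sub-↦-iterApp P k z-fresh) ⟩
    sub (z ↦ P) (iterApp k G₀ Gs z)  ≈⟨ sub-=β (z ↦ P) (sym N=G₀ᵏ) ⟩
    sub (z ↦ P) N                    ≡⟨ sub-↦-fresh N z∉N ⟩
    N                                ∎
    where open =β-Reasoning

  Θ-=β : apps Θ (G₀ ∷ Gs) =β N
  Θ-=β = trans (apps-=β Gs (Θ-unfold k G₀)) (iter-instance-=β (app Θ G₀))

  iterApp-suc-=β : iterApp (suc k) G₀ Gs z =β N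
  iterApp-suc-=β =
    ≡.subst (λ M → apps M Gs =β N) (iter-sucʳ k G₀ (var z)) (iter-instance-=β (app G₀ (var z)))

  compact : IsFPC (apps Θ (G₀ ∷ Gs)) → Compact z G₀ Gs
  compact Θ⃗G-FPC = suc k , FPC-transport Θ-FreeIn (trans Θ-=β (sym iterApp-suc-=β)) Θ⃗G-FPC
    where Θ-FreeIn : ∀ {x} → FreeIn x (apps Θ (G₀ ∷ Gs)) → FreeIn x (iterApp (suc k) G₀ Gs z)
          Θ-FreeIn = FreeIn-apps-mono [ ⊥-elim ∘ Θ-closed , inj₁ ] Gs

  weaklyConstant : IsWFPC (apps Θ (G₀ ∷ Gs)) → WeaklyConstant z G₀ Gs
  weaklyConstant Θ⃗G-WFPC = k , N , N=∞G₀ᵏ , z∉N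
    where
      x : ℕ
      x = bound (app N (apps Θ (G₀ ∷ Gs)))
      x-fresh : ¬ FreeIn x (app N (apps Θ (G₀ ∷ Gs)))
      x-fresh = bound-fresh (app N (apps Θ (G₀ ∷ Gs)))
      Nx=∞x[Nx] : app N (var x) =∞ app (var x) (app N (var x))
      Nx=∞x[Nx] j =
        BTeq-resp-=β j (Θ⃗G-WFPC x (x-fresh ∘ inj₂) j) (=β-appˡ Θ-=β) (=β-appʳ (=β-appˡ Θ-=β))
      N=∞G₀ᵏ : N =∞ iterApp k G₀ Gs z
      N=∞G₀ᵏ j = BTeq-resp-=β j (fixedPoint-=∞-refl (x-fresh ∘ inj₁) Nx=∞x[Nx] j) refl N=G₀ᵏ

constant-fgv⇒compact : ∀ {G₀ Gs z} → FreshFor z (G₀ ∷ Gs) →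
                       Constant z G₀ Gs → IsFGV G₀ Gs → Compact z G₀ Gs
constant-fgv⇒compact fresh (k , N , e , z∉N) fgv =
  Constancy.compact {k = k} {N} fresh e z∉N (fgv Θ Θ-FPC)

constant⇒weaklyConstant : ∀ {G₀ Gs z} → FreshFor z (G₀ ∷ Gs) →
                          Constant z G₀ Gs → IsWFPC (apps Θ (G₀ ∷ Gs)) → WeaklyConstant z G₀ Gs
constant⇒weaklyConstant fresh (k , N , e , z∉N) = Constancy.weaklyConstant {k = k} {N} fresh e z∉N

compact⇒weaklyCompact : ∀ {G₀ Gs z} → Compact z G₀ Gs → WeaklyCompact z G₀ Gs
compact⇒weaklyCompact = Product.map₂ FPC⇒WFPC

proposition4p6 : (G₀ : Term) (Gs : List Term) (z : ℕ) → FreshFor z (G₀ ∷ Gs) →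
    ((Constant z G₀ Gs × IsFGV G₀ Gs) → Compact z G₀ Gs) ×
    (((Constant z G₀ Gs × IsFGV G₀ Gs) ⊎ (Constant z G₀ Gs × IsWFGV G₀ Gs)) →
       WeaklyConstant z G₀ Gs) ×
    (((Compact z G₀ Gs × IsFGV G₀ Gs) ⊎ (Compact z G₀ Gs × IsWFGV G₀ Gs)) →
       WeaklyCompact z G₀ Gs)
proposition4p6 G₀ Gs z fresh =
    uncurry (constant-fgv⇒compact fresh)
  , [ uncurry (λ c fgv → constant⇒weaklyConstant fresh c (FPC⇒WFPC (fgv Θ Θ-FPC)))
    , uncurry (λ c wfgv → constant⇒weaklyConstant fresh c (wfgv Θ (FPC⇒WFPC Θ-FPC)))
    ]
  , compact⇒weaklyCompact {G₀} {Gs} ∘ [ proj₁ , proj₁ ]
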